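{- In the game $\mathcal{R}(K_{\aleph_0}, \hat{K}_{2,3})$, suppose that the three edges claimed by $P_1$ in her first three moves form a triangle $K_3$. Then, from the resulting position (after $P_2$'s third move, with $P_1$ to move), $P_1$ has a winning strategy.
   Context: The Strong Ramsey game $\mathcal{R}(K_{\aleph_0}, G)$: two players $P_1$ and $P_2$ alternately claim previously unclaimed edges of the complete graph $K_{\aleph_0}$ on a countably infinite vertex set, $P_1$ moving first; the first player to claim all edges of a copy of the finite graph $G$ in their own color wins, and if nobody does so in finitely many moves the game is a draw. For $t\in\mathbb{N}$, $\hat{K}_{2,t}$ is $K_{2,t}$ together with the edge joining the two vertices of the part of size $2$. -}

module Defs where

open import Data.Nat using (ℕ; zero; suc; _+_)
open import Data.Bool using (Bool; true; false; if_then_else_)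
open import Data.Fin using (Fin) renaming (zero to fz; suc to fs)
open import Data.List using (List; []; _∷_; _++_; [_]; length; map; allFin)
open import Data.List.Relation.Unary.Any using (Any)
open import Data.List.Relation.Unary.All using (All)
open import Data.Product using (Σ; _×_; _,_; proj₁)
open import Data.Sum using (_⊎_)
open import Relation.Nullary using (¬_)
open import Relation.Binary.PropositionalEquality using (_≡_; _≢_)
open import Function.Definitions using (Injective)

-- Vertices of K_ℵ₀ are natural numbers.  An edge is written as an
-- (ordered) pair of distinct vertices, read as the unordered pair {a,b}.
Edge : Set
Edge = ℕ × ℕ

SameEdge : Edge → Edge → Set
SameEdge (a , b) (c , d) = (a ≡ c × b ≡ d) ⊎ (a ≡ d × b ≡ c)

Claimed : Edge → List Edge → Set
Claimed e es = Any (SameEdge e) es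

ProperEdge : Edge → Set
ProperEdge (a , b) = a ≢ b

-- A history: the list of all edges claimed so far, in chronological order.
-- Moves 0,2,4,… belong to P₁, moves 1,3,5,… to P₂.
History : Set
History = List Edge

mutual
  evens : {A : Set} → List A → List A
  evens []       = []
  evens (x ∷ xs) = x ∷ odds xs

  odds : {A : Set} → List A → List A
  odds []       = []
  odds (x ∷ xs) = evens xs

P1edges : History → List Edge
P1edges = evens

P2edges : History → List Edge
P2edges = odds

ValidMove : History → Edge → Set
ValidMove h e = ProperEdge e × ¬ Claimed e h

LegalMove : History → Set
LegalMove h = Σ Edge (ValidMove h)

data LegalHistory : History → Set where
  empty : LegalHistory []
  snoc  : ∀ {h e} → LegalHistory h → ValidMove h e → LegalHistory (h ++ [ e ])

Strategy : Set
Strategy = (h : History) → LegalMove h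

isEven : ℕ → Bool
isEven zero          = true
isEven (suc zero)    = false
isEven (suc (suc n)) = isEven n

play : Strategy → Strategy → History → ℕ → History
play σ τ p zero    = p
play σ τ p (suc n) =
  let h = play σ τ p n in
  h ++ [ proj₁ (if isEven (length h) then σ h else τ h) ]

record Graph : Set where
  field
    size  : ℕ
    edges : List (Fin size × Fin size)
open Graph public

HasCopy : Graph → List Edge → Set
HasCopy G es =
  Σ (Fin (size G) → ℕ) λ f →
    Injective _≡_ _≡_ f ×
    All (λ ij → Claimed (f (proj₁ ij) , f (Data.Product.proj₂ ij)) es) (edges G)

-- K̂_{2,t}: vertices 0,1 form the part of size 2, vertices 2,…,t+1 the
-- part of size t; edges 0–1 and i–(2+j) for i ∈ {0,1}, j < t.
K̂₂ : ℕ → Graph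
K̂₂ t = record
  { size  = 2 + t
  ; edges = (fz , fs fz)
          ∷ (map (λ j → (fz , fs (fs j))) (allFin t)
          ++ map (λ j → (fs fz , fs (fs j))) (allFin t))
  }

-- P₁ has won in position h of the game R(K_ℵ₀, G): P₁ has a copy of G
-- and P₂ has none (copies persist, and moves alternate, so P₁ completed
-- hers first).
P1Wins : Graph → History → Set
P1Wins G h = HasCopy G (P1edges h) × ¬ HasCopy G (P2edges h)

P1WinningFrom : Graph → History → Strategy → Set
P1WinningFrom G p σ = (τ : Strategy) → Σ ℕ λ n → P1Wins G (play σ τ p n)

P1Triangle : History → Set
P1Triangle h =
  Σ ℕ λ a → Σ ℕ λ b → Σ ℕ λ c →
    a ≢ b × b ≢ c × a ≢ c ×
    Claimed (a , b) (P1edges h) × Claimed (b , c) (P1edges h) ×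
    Claimed (a , c) (P1edges h)

{-# OPTIONS --safe #-}
module Submission where

-- P₁ joins two vertices a, S of her triangle to a fresh vertex X and names them U, V so that V has
-- at most two neighbours among P₂'s first five edges F: since P₁ owns aS, deg_F a + deg_F S ≤ 5.
-- With W the third vertex of the triangle and fresh vertices Y, Z, T, each later move of P₁ threatens
-- to complete a book K̂₂,₃ with spines UV or UX, which forces P₂ to block with VY, VZ and XZ, until
-- the double threat VT, XT wins.  P₂ has no book: Y and Z lie on none, because a vertex with at most
-- three neighbours can only be a page, which would make V or X a spine although they have too few
-- neighbours; and without the blocks at Y and Z she owns at most six edges.

open import Defs
open import Data.List using (length)
open import Data.Product using (Σ)
open import Relation.Binary.PropositionalEquality using (_≡_)

open import Data.Bool using (if_then_else_)
open import Data.Empty using (⊥; ⊥-elim)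
open import Data.Fin using (Fin; punchIn) renaming (zero to fz; suc to fs)
import Data.Fin.Properties as Fin
open import Data.List using (List; []; _∷_; _++_; [_]; lookup; take)
open import Data.List.Membership.Propositional using (_∈_)
open import Data.List.Membership.Propositional.Properties using (∈-allFin; ∈-lookup; ∈-++⁺ˡ; ∈-++⁺ʳ; ∈-map⁺)
open import Data.List.Membership.Setoid.Properties using (∈-resp-≈)
open import Data.List.Properties using (length-++)
open import Data.List.Relation.Unary.All using (All; []; _∷_)
import Data.List.Relation.Unary.All as All
open import Data.List.Relation.Unary.All.Properties using (¬Any⇒All¬; All¬⇒¬Any)
open import Data.List.Relation.Unary.AllPairs using (AllPairs; []; _∷_)
import Data.List.Relation.Unary.AllPairs.Properties as AllPairs
open import Data.List.Relation.Unary.Any using (Any; here; there; index; any?)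
open import Data.List.Relation.Unary.Any.Properties using (++⁺ˡ; ++⁺ʳ; ++⁻; lookup-index)
open import Data.List.Relation.Unary.Unique.Setoid using (Unique)
open import Data.Nat using (ℕ; suc; _+_; _≤_; _<_; z≤n; s≤s; _≟_; _≤?_)
open import Data.Nat.Properties
  using (≤-refl; ≤-reflexive; ≤-trans; <-trans; <⇒≱; <⇒≢; ≰⇒>; n<1+n; m≤m+n; m≤n+m;
         +-mono-≤; +-monoˡ-≤; +-cancelˡ-≤; +-commutativeSemigroup; module ≤-Reasoning)
open import Algebra.Properties.CommutativeSemigroup +-commutativeSemigroup using (interchange)
open import Data.Product using (_×_; _,_; proj₁; proj₂; ∃; map; swap)
open import Data.Sum using (_⊎_; inj₁; inj₂)
open import Function using (_∘_)
open import Function.Definitions using (Injective)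
open import Relation.Binary.Bundles using (Setoid)
import Relation.Binary.PropositionalEquality as ≡
open import Relation.Binary.PropositionalEquality using (_≢_; ≢-sym; refl; sym; trans; cong; cong₂; subst)
open import Relation.Nullary using (¬_; Dec; yes; no; does)
open import Relation.Nullary.Decidable using (_×-dec_; _⊎-dec_; _→-dec_; ¬?; toWitness; decidable-stable)

private
  variable
    u v w p q s : ℕ
    N : List ℕ
    e d : Edge
    L L′ : List Edge

sameEdge-sym : SameEdge e d → SameEdge d e
sameEdge-sym (inj₁ (p , q)) = inj₁ (sym p , sym q)
sameEdge-sym (inj₂ (p , q)) = inj₂ (sym q , sym p)

sameEdge-trans : ∀ {g} → SameEdge e d → SameEdge d g → SameEdge e g
sameEdge-trans (inj₁ (p , q)) (inj₁ (r , s)) = inj₁ (trans p r , trans q s)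
sameEdge-trans (inj₁ (p , q)) (inj₂ (r , s)) = inj₂ (trans p r , trans q s)
sameEdge-trans (inj₂ (p , q)) (inj₁ (r , s)) = inj₂ (trans p s , trans q r)
sameEdge-trans (inj₂ (p , q)) (inj₂ (r , s)) = inj₁ (trans p s , trans q r)

edgeSetoid : Setoid _ _
edgeSetoid = record
  { Carrier       = Edge
  ; _≈_           = SameEdge
  ; isEquivalence = record { refl = inj₁ (refl , refl) ; sym = sameEdge-sym ; trans = sameEdge-trans }
  }

sameEdge-flip : SameEdge (u , w) (w , u)
sameEdge-flip = inj₂ (refl , refl)

played : ∀ {m} → m ≡ e → SameEdge e m
played refl = inj₁ (refl , refl)

claimed-resp : SameEdge e d → Claimed d L → Claimed e L
claimed-resp e≈d = ∈-resp-≈ edgeSetoid (sameEdge-sym e≈d)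

claimed-flip : Claimed (u , w) L → Claimed (w , u) L
claimed-flip = claimed-resp sameEdge-flip

claimed-++-monoʳ : ∀ A {M M′} → (∀ {e} → Claimed e M → Claimed e M′) → Claimed e (A ++ M) → Claimed e (A ++ M′)
claimed-++-monoʳ A M⊆M′ c with ++⁻ A c
... | inj₁ cA = ++⁺ˡ cA
... | inj₂ cM = ++⁺ʳ A (M⊆M′ cM)

sameEdge? : (e d : Edge) → Dec (SameEdge e d)
sameEdge? (a , b) (c , d) = ((a ≟ c) ×-dec (b ≟ d)) ⊎-dec ((a ≟ d) ×-dec (b ≟ c))

claimed? : (e : Edge) (L : List Edge) → Dec (Claimed e L)
claimed? e = any? (sameEdge? e)

≉-resp : ∀ {x} → SameEdge d x → ¬ SameEdge e d → ¬ SameEdge e x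
≉-resp d≈x e≉d e≈x = e≉d (sameEdge-trans e≈x (sameEdge-sym d≈x))

≉-at-first : u ≢ p → u ≢ q → ¬ SameEdge (u , w) (p , q)
≉-at-first u≢p _ (inj₁ (u≡p , _)) = u≢p u≡p
≉-at-first _ u≢q (inj₂ (u≡q , _)) = u≢q u≡q

≉-at-second : w ≢ q → w ≢ p → ¬ SameEdge (u , w) (p , q)
≉-at-second w≢q _ (inj₁ (_ , w≡q)) = w≢q w≡q
≉-at-second _ w≢p (inj₂ (_ , w≡p)) = w≢p w≡p

unclaimed-++ : ∀ A {M} → ¬ Claimed e A → All (λ m → ¬ SameEdge e m) M → ¬ Claimed e (A ++ M)
unclaimed-++ A e∉A e∉M c with ++⁻ A c
... | inj₁ cA = e∉A cA
... | inj₂ cM = All¬⇒¬Any e∉M cM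

Touches : ℕ → Edge → Set
Touches v e = ∃ λ w → SameEdge (v , w) e

touches? : ∀ v e → Dec (Touches v e)
touches? v (a , b) with a ≟ v | b ≟ v
... | yes a≡v | _       = yes (b , inj₁ (sym a≡v , refl))
... | no _    | yes b≡v = yes (a , inj₂ (sym b≡v , refl))
... | no a≢v  | no b≢v  = no neither
  where
    neither : ¬ Touches v (a , b)
    neither (_ , inj₁ (v≡a , _)) = a≢v (sym v≡a)
    neither (_ , inj₂ (v≡b , _)) = b≢v (sym v≡b)

proper-endpoints : ProperEdge e → SameEdge (u , w) e → u ≢ w
proper-endpoints proper (inj₁ (u≡a , w≡b)) u≡w = proper (trans (sym u≡a) (trans u≡w w≡b))
proper-endpoints proper (inj₂ (u≡b , w≡a)) u≡w = proper (trans (sym w≡a) (trans (sym u≡w) u≡b))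

other-endpoint : ProperEdge e → SameEdge (u , v) e → SameEdge (u , w) e → w ≡ v
other-endpoint proper uv≈e uw≈e with sameEdge-trans uw≈e (sameEdge-sym uv≈e)
... | inj₁ (_ , w≡v) = w≡v
... | inj₂ (u≡v , _) = ⊥-elim (proper-endpoints proper uv≈e u≡v)

shared-endpoint : SameEdge (u , v) e → SameEdge (p , q) e → u ≢ p → v ≡ p
shared-endpoint uv≈e pq≈e u≢p with sameEdge-trans uv≈e (sameEdge-sym pq≈e)
... | inj₁ (u≡p , _) = ⊥-elim (u≢p u≡p)
... | inj₂ (_ , v≡p) = v≡p

untouched : SameEdge (p , q) e → v ≢ p → ¬ SameEdge (p , v) e → ¬ Touches v e
untouched {p = p} {e = e} pq≈e v≢p pv≉e (_ , vw≈e) with sameEdge-trans vw≈e (sameEdge-sym pq≈e)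
... | inj₁ (v≡p , _) = v≢p v≡p
... | inj₂ (v≡q , _) = pv≉e (subst (λ x → SameEdge (p , x) e) (sym v≡q) pq≈e)

vertexSum : List Edge → ℕ
vertexSum []            = 0
vertexSum ((a , b) ∷ L) = a + b + vertexSum L

fresh : List Edge → ℕ
fresh L = suc (vertexSum L)

endpoints≤vertexSum : ∀ a b L → a ≤ vertexSum ((a , b) ∷ L) × b ≤ vertexSum ((a , b) ∷ L)
endpoints≤vertexSum a b L =
  ≤-trans (m≤m+n a b) (m≤m+n (a + b) (vertexSum L)) , ≤-trans (m≤n+m b a) (m≤m+n (a + b) (vertexSum L))

claimed⇒≤vertexSum : ∀ L → Claimed (u , w) L → u ≤ vertexSum L × w ≤ vertexSum L
claimed⇒≤vertexSum ((a , b) ∷ L) (here (inj₁ (refl , refl))) = endpoints≤vertexSum a b L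
claimed⇒≤vertexSum ((a , b) ∷ L) (here (inj₂ (refl , refl))) = swap (endpoints≤vertexSum a b L)
claimed⇒≤vertexSum ((a , b) ∷ L) (there c) =
  map (λ le → ≤-trans le tail≤) (λ le → ≤-trans le tail≤) (claimed⇒≤vertexSum L c)
  where tail≤ = m≤n+m (vertexSum L) (a + b)

claimed⇒<fresh : ∀ L → Claimed (u , w) L → u < fresh L × w < fresh L
claimed⇒<fresh L c = map s≤s s≤s (claimed⇒≤vertexSum L c)

Isolated : ℕ → List Edge → Set
Isolated v L = ∀ {w} → ¬ Claimed (v , w) L

fresh-isolated : ∀ L → fresh L ≤ v → Isolated v L
fresh-isolated L le c = <⇒≱ (proj₁ (claimed⇒<fresh L c)) le

fresh-unclaimed : ∀ L → ¬ Claimed (u , fresh L) L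
fresh-unclaimed L = fresh-isolated L ≤-refl ∘ claimed-flip

mutual
  evens-⊆ : ∀ {A : Set} {P : A → Set} xs → Any P (evens xs) → Any P xs
  evens-⊆ (x ∷ xs) (here px) = here px
  evens-⊆ (x ∷ xs) (there a) = there (odds-⊆ xs a)

  odds-⊆ : ∀ {A : Set} {P : A → Set} xs → Any P (odds xs) → Any P xs
  odds-⊆ (x ∷ xs) a = there (evens-⊆ xs a)

legal⇒unique : ∀ {h} → LegalHistory h → Unique edgeSetoid h
legal⇒unique empty = []
legal⇒unique (snoc {h} legal (_ , e∉h)) =
  AllPairs.++⁺ (legal⇒unique legal) ([] ∷ []) (All.map (λ e≉x → (e≉x ∘ sameEdge-sym) ∷ []) (¬Any⇒All¬ h e∉h))

sameEdge-excluded : All (λ x → ¬ SameEdge d x) L → SameEdge e d → ¬ Claimed e L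
sameEdge-excluded d∉L e≈d = All¬⇒¬Any (All.map (λ d≉x e≈x → d≉x (sameEdge-trans (sameEdge-sym e≈d) e≈x)) d∉L)

mutual
  evens-odds-disjoint : ∀ {h} → Unique edgeSetoid h → Claimed e (evens h) → ¬ Claimed e (odds h)
  evens-odds-disjoint {h = x ∷ xs} (x∉xs ∷ _) (here e≈x) c  = sameEdge-excluded x∉xs e≈x (evens-⊆ xs c)
  evens-odds-disjoint {h = x ∷ xs} (_ ∷ xs-unique) (there c) c′ = odds-evens-disjoint xs-unique c c′

  odds-evens-disjoint : ∀ {h} → Unique edgeSetoid h → Claimed e (odds h) → ¬ Claimed e (evens h)
  odds-evens-disjoint {h = x ∷ xs} (x∉xs ∷ _) c (here e≈x)  = sameEdge-excluded x∉xs e≈x (evens-⊆ xs c)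
  odds-evens-disjoint {h = x ∷ xs} (_ ∷ xs-unique) c (there c′) = evens-odds-disjoint xs-unique c c′

NbrsWithin : List Edge → ℕ → List ℕ → Set
NbrsWithin L v N = ∀ {w} → Claimed (v , w) L → w ∈ N

nbrsWithin-++ : ∀ A {B M N} → NbrsWithin A v M → NbrsWithin B v N → NbrsWithin (A ++ B) v (M ++ N)
nbrsWithin-++ A {M = M} A⊆M B⊆N c with ++⁻ A c
... | inj₁ cA = ∈-++⁺ˡ (A⊆M cA)
... | inj₂ cB = ∈-++⁺ʳ M (B⊆N cB)

isolated⇒nbrsWithin-[] : Isolated v L → NbrsWithin L v []
isolated⇒nbrsWithin-[] iso c = ⊥-elim (iso c)

nbrsOf : ℕ → Edge → List ℕ
nbrsOf v (a , b) with a ≟ v | b ≟ v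
... | yes _ | _     = [ b ]
... | no _  | yes _ = [ a ]
... | no _  | no _  = []

nbrs : ℕ → List Edge → List ℕ
nbrs v []      = []
nbrs v (e ∷ L) = nbrsOf v e ++ nbrs v L

nbrsOf-sound : ∀ v e → NbrsWithin [ e ] v (nbrsOf v e)
nbrsOf-sound v (a , b) c with a ≟ v | b ≟ v
nbrsOf-sound v (a , b) (here (inj₁ (_ , w≡b)))   | yes _   | _      = here w≡b
nbrsOf-sound v (a , b) (here (inj₂ (v≡b , w≡a))) | yes a≡v | _      = here (trans w≡a (trans a≡v v≡b))
nbrsOf-sound v (a , b) (here (inj₁ (v≡a , _)))   | no a≢v  | _      = ⊥-elim (a≢v (sym v≡a))
nbrsOf-sound v (a , b) (here (inj₂ (_ , w≡a)))   | no _    | yes _  = here w≡a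
nbrsOf-sound v (a , b) (here (inj₂ (v≡b , _)))   | no _    | no b≢v = ⊥-elim (b≢v (sym v≡b))

nbrs-sound : ∀ v L → NbrsWithin L v (nbrs v L)
nbrs-sound v (e ∷ L) = nbrsWithin-++ [ e ] (nbrsOf-sound v e) (nbrs-sound v L)

length-nbrsOf : ∀ v e → length (nbrsOf v e) ≤ 1
length-nbrsOf v (a , b) with a ≟ v | b ≟ v
... | yes _ | _     = ≤-refl
... | no _  | yes _ = ≤-refl
... | no _  | no _  = z≤n

length-nbrs : ∀ v L → length (nbrs v L) ≤ length L
length-nbrs v []      = z≤n
length-nbrs v (e ∷ L) rewrite length-++ (nbrsOf v e) {nbrs v L} =
  +-mono-≤ (length-nbrsOf v e) (length-nbrs v L)

nbrsOf-pair : ∀ e → u ≢ w → ¬ SameEdge e (u , w) → length (nbrsOf u e) + length (nbrsOf w e) ≤ 1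
nbrsOf-pair {u} {w} (a , b) u≢w e≉uw with a ≟ u | b ≟ u | a ≟ w | b ≟ w
... | yes a≡u | _       | yes a≡w | _       = ⊥-elim (u≢w (trans (sym a≡u) a≡w))
... | yes a≡u | _       | no _    | yes b≡w = ⊥-elim (e≉uw (inj₁ (a≡u , b≡w)))
... | yes _   | _       | no _    | no _    = ≤-refl
... | no _    | yes b≡u | yes a≡w | _       = ⊥-elim (e≉uw (inj₂ (a≡w , b≡u)))
... | no _    | yes b≡u | no _    | yes b≡w = ⊥-elim (u≢w (trans (sym b≡u) b≡w))
... | no _    | yes _   | no _    | no _    = ≤-refl
... | no _    | no _    | yes _   | _       = ≤-refl
... | no _    | no _    | no _    | yes _   = ≤-refl
... | no _    | no _    | no _    | no _    = z≤n

degree-sum : ∀ L → u ≢ w → ¬ Claimed (u , w) L → length (nbrs u L) + length (nbrs w L) ≤ length L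
degree-sum []      _   _      = z≤n
degree-sum {u} {w} (e ∷ L) u≢w uw∉eL = begin
  length (nbrsOf u e ++ nbrs u L) + length (nbrsOf w e ++ nbrs w L)
    ≡⟨ cong₂ _+_ (length-++ (nbrsOf u e)) (length-++ (nbrsOf w e)) ⟩
  (length (nbrsOf u e) + length (nbrs u L)) + (length (nbrsOf w e) + length (nbrs w L))
    ≡⟨ interchange (length (nbrsOf u e)) _ _ _ ⟩
  (length (nbrsOf u e) + length (nbrsOf w e)) + (length (nbrs u L) + length (nbrs w L))
    ≤⟨ +-mono-≤ (nbrsOf-pair e u≢w (uw∉eL ∘ here ∘ sameEdge-sym)) (degree-sum L u≢w (uw∉eL ∘ there)) ⟩
  suc (length L) ∎
  where open ≤-Reasoning

m≰2⇒m+n≤5⇒n≤2 : ∀ {m n} → ¬ m ≤ 2 → m + n ≤ 5 → n ≤ 2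
m≰2⇒m+n≤5⇒n≤2 {m} {n} m≰2 m+n≤5 = +-cancelˡ-≤ 3 n 2 (≤-trans (+-monoˡ-≤ n (≰⇒> m≰2)) m+n≤5)

length-∷ʳ≤ : ∀ (M : List ℕ) {x : ℕ} → length M ≤ 2 → length (M ++ [ x ]) ≤ 3
length-∷ʳ≤ M small = ≤-trans (≤-reflexive (length-++ M)) (+-mono-≤ small (≤-refl {1}))

module _ {c ℓ} (S : Setoid c ℓ) where
  open Setoid S using (Carrier; _≈_) renaming (sym to ≈-sym; trans to ≈-trans)
  open import Data.List.Membership.Setoid S using () renaming (_∈_ to _∈ₛ_)

  distinct-members≤length : ∀ {m ys} (g : Fin m → Carrier) →
                            (∀ {i j} → g i ≈ g j → i ≡ j) → (∀ i → g i ∈ₛ ys) → m ≤ length ys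
  distinct-members≤length {ys = ys} g g-injective g∈ys = Fin.injective⇒≤ position-injective
    where
      position-injective : ∀ {i j} → index (g∈ys i) ≡ index (g∈ys j) → i ≡ j
      position-injective {i} {j} same = g-injective (≈-trans (lookup-index (g∈ys i))
        (subst (λ k → lookup ys k ≈ g j) (sym same) (≈-sym (lookup-index (g∈ys j)))))

Avoids : ∀ {n} → (Fin n → ℕ) → ℕ → Set
Avoids f v = ∀ i → f i ≢ v

copy-mono : ∀ {G} → (∀ {e} → Claimed e L → Claimed e L′) → HasCopy G L → HasCopy G L′
copy-mono L⊆L′ (f , f-injective , claims) = f , f-injective , All.map L⊆L′ claims

copy-restrict : ∀ {G} (copy : HasCopy G L) →
                (∀ {u w} → Claimed (u , w) L → Claimed (u , w) L′ ⊎ (Avoids (proj₁ copy) u ⊎ Avoids (proj₁ copy) w)) →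
                HasCopy G L′
copy-restrict (f , f-injective , claims) restrict = f , f-injective , All.map kept claims
  where
    kept : ∀ {ij} → Claimed (f (proj₁ ij) , f (proj₂ ij)) _ → Claimed (f (proj₁ ij) , f (proj₂ ij)) _
    kept {i , j} c with restrict c
    ... | inj₁ c′              = c′
    ... | inj₂ (inj₁ avoids-i) = ⊥-elim (avoids-i i refl)
    ... | inj₂ (inj₂ avoids-j) = ⊥-elim (avoids-j j refl)

SamePair : ∀ {A : Set} → A × A → A × A → Set
SamePair (a , b) (c , d) = (a ≡ c × b ≡ d) ⊎ (a ≡ d × b ≡ c)

DistinctEdges : Graph → Set
DistinctEdges G = ∀ k l → SamePair (lookup (edges G) k) (lookup (edges G) l) → k ≡ l

copy-size : ∀ {G} → DistinctEdges G → HasCopy G L → length (edges G) ≤ length L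
copy-size {G = G} distinct (f , f-injective , claims) =
  distinct-members≤length edgeSetoid image image-injective (λ k → All.lookup claims (∈-lookup k))
  where
    image : Fin (length (edges G)) → Edge
    image k = f (proj₁ (lookup (edges G) k)) , f (proj₂ (lookup (edges G) k))
    image-injective : ∀ {k l} → SameEdge (image k) (image l) → k ≡ l
    image-injective {k} {l} (inj₁ (p , q)) = distinct k l (inj₁ (f-injective p , f-injective q))
    image-injective {k} {l} (inj₂ (p , q)) = distinct k l (inj₂ (f-injective p , f-injective q))

K̂₂₃-distinctEdges : DistinctEdges (K̂₂ 3)
K̂₂₃-distinctEdges =
  toWitness {a? = Fin.all? λ k → Fin.all? λ l → samePair? (lookup es k) (lookup es l) →-dec (k Fin.≟ l)} _
  where
    es = edges (K̂₂ 3)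
    samePair? : (x y : Fin 5 × Fin 5) → Dec (SamePair x y)
    samePair? (a , b) (c , d) = ((a Fin.≟ c) ×-dec (b Fin.≟ d)) ⊎-dec ((a Fin.≟ d) ×-dec (b Fin.≟ c))

small-graph-K̂₂₃-free : length L ≤ 6 → ¬ HasCopy (K̂₂ 3) L
small-graph-K̂₂₃-free small copy = <⇒≱ (copy-size K̂₂₃-distinctEdges copy) small

-- Books

module K̂₂-Copy {t : ℕ} {L : List Edge} (copy : HasCopy (K̂₂ t) L) where

  vertex : Fin (2 + t) → ℕ
  vertex = proj₁ copy

  vertex-injective : Injective _≡_ _≡_ vertex
  vertex-injective = proj₁ (proj₂ copy)

  edge : ∀ {ij} → ij ∈ edges (K̂₂ t) → Claimed (vertex (proj₁ ij) , vertex (proj₂ ij)) L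
  edge = All.lookup (proj₂ (proj₂ copy))

  data Spine : Fin (2 + t) → Set where
    spine₀ : Spine fz
    spine₁ : Spine (fs fz)

  spine-adjacent : ∀ {i} → Spine i → ∀ j → j ≢ i → Claimed (vertex i , vertex j) L
  spine-adjacent spine₀ fz          j≢i = ⊥-elim (j≢i refl)
  spine-adjacent spine₀ (fs fz)     _   = edge (here refl)
  spine-adjacent spine₀ (fs (fs j)) _   = edge (there (∈-++⁺ˡ (∈-map⁺ _ (∈-allFin j))))
  spine-adjacent spine₁ fz          _   = claimed-flip (edge (here refl))
  spine-adjacent spine₁ (fs fz)     j≢i = ⊥-elim (j≢i refl)
  spine-adjacent spine₁ (fs (fs j)) _   = edge (there (∈-++⁺ʳ _ (∈-map⁺ _ (∈-allFin j))))

  SpineVertex : ℕ → Set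
  SpineVertex v = ∃ λ i → Spine i × vertex i ≡ v

  spines-distinct : vertex fz ≢ vertex (fs fz)
  spines-distinct eq with vertex-injective eq
  ... | ()

  CoveredBy : ℕ → List ℕ → Set
  CoveredBy v N = ∀ {w} → Claimed (v , w) L → w ∈ N ⊎ Avoids vertex w

  covered-vertex : ∀ {v N j} → CoveredBy v N → Claimed (v , vertex j) L → vertex j ∈ N
  covered-vertex cover c with cover c
  ... | inj₁ w∈N   = w∈N
  ... | inj₂ avoid = ⊥-elim (avoid _ refl)

  spine-degree : ∀ {v N} → SpineVertex v → CoveredBy v N → suc t ≤ length N
  spine-degree (i , spine , refl) cover =
    distinct-members≤length (≡.setoid ℕ) (vertex ∘ punchIn i) (Fin.punchIn-injective i _ _ ∘ vertex-injective)
      (λ k → covered-vertex cover (spine-adjacent spine (punchIn i k) (Fin.punchInᵢ≢i i k)))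

  not-spine : ∀ {v N} → CoveredBy v N → length N ≤ t → ¬ SpineVertex v
  not-spine cover small spine = <⇒≱ (spine-degree spine cover) small

  low-degree⇒adjacent-to-spines : ∀ {i v N} → vertex i ≡ v → CoveredBy v N → length N ≤ t →
                                  vertex fz ∈ N × vertex (fs fz) ∈ N
  low-degree⇒adjacent-to-spines {fz}        refl cover small = ⊥-elim (not-spine cover small (fz , spine₀ , refl))
  low-degree⇒adjacent-to-spines {fs fz}     refl cover small = ⊥-elim (not-spine cover small (fs fz , spine₁ , refl))
  low-degree⇒adjacent-to-spines {fs (fs j)} refl cover _     =
    covered-vertex cover (claimed-flip (spine-adjacent spine₀ (fs (fs j)) λ ())) ,
    covered-vertex cover (claimed-flip (spine-adjacent spine₁ (fs (fs j)) λ ()))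

  pendant-avoided : ∀ {v α} → 1 ≤ t → CoveredBy v [ α ] → Avoids vertex v
  pendant-avoided small cover i on with low-degree⇒adjacent-to-spines on cover small
  ... | here p , here q = spines-distinct (trans p (sym q))

  both-spines : ∀ {i v α β} → 2 ≤ t → vertex i ≡ v → CoveredBy v (α ∷ β ∷ []) → SpineVertex α × SpineVertex β
  both-spines small on cover with low-degree⇒adjacent-to-spines on cover small
  ... | here p         , here q         = ⊥-elim (spines-distinct (trans p (sym q)))
  ... | here p         , there (here q) = (fz , spine₀ , p) , (fs fz , spine₁ , q)
  ... | there (here p) , here q         = (fs fz , spine₁ , q) , (fz , spine₀ , p)
  ... | there (here p) , there (here q) = ⊥-elim (spines-distinct (trans p (sym q)))

  spine-among-first-two : ∀ {i v α β γ} → 3 ≤ t → vertex i ≡ v → CoveredBy v (α ∷ β ∷ γ ∷ []) →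
                          SpineVertex α ⊎ SpineVertex β
  spine-among-first-two small on cover with low-degree⇒adjacent-to-spines on cover small
  ... | here p                 , _                      = inj₁ (fz , spine₀ , p)
  ... | there (here p)         , _                      = inj₂ (fz , spine₀ , p)
  ... | there (there (here _)) , here q                 = inj₁ (fs fz , spine₁ , q)
  ... | there (there (here _)) , there (here q)         = inj₂ (fs fz , spine₁ , q)
  ... | there (there (here p)) , there (there (here q)) = ⊥-elim (spines-distinct (trans p (sym q)))

record Triangle (L : List Edge) (x y z : ℕ) : Set where
  field
    x≢y : x ≢ y
    y≢z : y ≢ z
    x≢z : x ≢ z
    xy  : Claimed (x , y) L
    yz  : Claimed (y , z) L
    xz  : Claimed (x , z) L

triangle-mono : ∀ {x y z} → (∀ {e} → Claimed e L → Claimed e L′) → Triangle L x y z → Triangle L′ x y z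
triangle-mono L⊆L′ t = record { x≢y = x≢y ; y≢z = y≢z ; x≢z = x≢z ; xy = L⊆L′ xy ; yz = L⊆L′ yz ; xz = L⊆L′ xz }
  where open Triangle t

triangle-swap₁₂ : ∀ {x y z} → Triangle L x y z → Triangle L y x z
triangle-swap₁₂ t = record { x≢y = ≢-sym x≢y ; y≢z = x≢z ; x≢z = y≢z ; xy = claimed-flip xy ; yz = xz ; xz = yz }
  where open Triangle t

triangle-swap₂₃ : ∀ {x y z} → Triangle L x y z → Triangle L x z y
triangle-swap₂₃ t = record { x≢y = x≢z ; y≢z = ≢-sym y≢z ; x≢z = x≢y ; xy = xz ; yz = claimed-flip yz ; xz = xy }
  where open Triangle t

lookup-injective : ∀ {xs : List ℕ} → AllPairs _≢_ xs → Injective _≡_ _≡_ (lookup xs)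
lookup-injective {x ∷ xs} (_  ∷ _)        {fz}   {fz}   _  = refl
lookup-injective {x ∷ xs} (x∉ ∷ _)        {fz}   {fs j} eq = ⊥-elim (All.lookup x∉ (∈-lookup j) eq)
lookup-injective {x ∷ xs} (x∉ ∷ _)        {fs i} {fz}   eq = ⊥-elim (All.lookup x∉ (∈-lookup i) (sym eq))
lookup-injective {x ∷ xs} (_  ∷ distinct) {fs i} {fs j} eq = cong fs (lookup-injective distinct eq)

book-copy : ∀ {s₁ s₂ p₁ p₂ p₃} → Triangle L s₁ s₂ p₁ → s₁ < p₂ → s₂ < p₂ → p₁ < p₂ → p₂ < p₃ →
            Claimed (s₁ , p₂) L → Claimed (s₂ , p₂) L → Claimed (s₁ , p₃) L → Claimed (s₂ , p₃) L →
            HasCopy (K̂₂ 3) L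
book-copy {s₁ = s₁} {s₂} {p₁} {p₂} {p₃} t s₁<p₂ s₂<p₂ p₁<p₂ p₂<p₃ s₁p₂ s₂p₂ s₁p₃ s₂p₃ =
  lookup vertices , lookup-injective distinct , xy ∷ xz ∷ s₁p₂ ∷ s₁p₃ ∷ yz ∷ s₂p₂ ∷ s₂p₃ ∷ []
  where
    open Triangle t
    vertices : List ℕ
    vertices = s₁ ∷ s₂ ∷ p₁ ∷ p₂ ∷ p₃ ∷ []
    distinct : AllPairs _≢_ vertices
    distinct = (x≢y ∷ x≢z ∷ <⇒≢ s₁<p₂ ∷ <⇒≢ (<-trans s₁<p₂ p₂<p₃) ∷ [])
             ∷ (y≢z ∷ <⇒≢ s₂<p₂ ∷ <⇒≢ (<-trans s₂<p₂ p₂<p₃) ∷ [])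
             ∷ (<⇒≢ p₁<p₂ ∷ <⇒≢ (<-trans p₁<p₂ p₂<p₃) ∷ [])
             ∷ (<⇒≢ p₂<p₃ ∷ [])
             ∷ [] ∷ []

-- P₂'s graph

-- F stands for P₂'s first five edges, VY, VZ, XZ for her forced blocks and r for one further edge.
module Blockade (F : List Edge) (F-small : length F ≤ 5)
                {V : ℕ} {NV : List ℕ} (V-nbrs : NbrsWithin F V NV) (NV-small : length NV ≤ 2) where

  module _ {X Y Z : ℕ} {NX : List ℕ} (X-nbrs : NbrsWithin F X NX) (NX-small : length NX ≤ 2)
           (Y-isolated : Isolated Y F) (Z-isolated : Isolated Z F)
           (V≢X : V ≢ X) (V≢Y : V ≢ Y) (V≢Z : V ≢ Z) (X≢Y : X ≢ Y) (X≢Z : X ≢ Z) (Y≢Z : Y ≢ Z)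
           {r : Edge} (r-proper : ProperEdge r)
           (r-new : ¬ Claimed r ((V , Y) ∷ (V , Z) ∷ (X , Z) ∷ (V , X) ∷ (X , Y) ∷ [])) where

    Blocks : List Edge
    Blocks = (V , Y) ∷ (V , Z) ∷ (X , Z) ∷ []

    blocks-nbrs-V : NbrsWithin Blocks V (Y ∷ Z ∷ [])
    blocks-nbrs-V (here (inj₁ (_ , w≡Y)))                = here w≡Y
    blocks-nbrs-V (here (inj₂ (V≡Y , _)))                = ⊥-elim (V≢Y V≡Y)
    blocks-nbrs-V (there (here (inj₁ (_ , w≡Z))))        = there (here w≡Z)
    blocks-nbrs-V (there (here (inj₂ (V≡Z , _))))        = ⊥-elim (V≢Z V≡Z)
    blocks-nbrs-V (there (there (here (inj₁ (V≡X , _))))) = ⊥-elim (V≢X V≡X)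
    blocks-nbrs-V (there (there (here (inj₂ (V≡Z , _))))) = ⊥-elim (V≢Z V≡Z)

    blocks-nbrs-X : NbrsWithin Blocks X [ Z ]
    blocks-nbrs-X (here (inj₁ (X≡V , _)))                = ⊥-elim (V≢X (sym X≡V))
    blocks-nbrs-X (here (inj₂ (X≡Y , _)))                = ⊥-elim (X≢Y X≡Y)
    blocks-nbrs-X (there (here (inj₁ (X≡V , _))))        = ⊥-elim (V≢X (sym X≡V))
    blocks-nbrs-X (there (here (inj₂ (X≡Z , _))))        = ⊥-elim (X≢Z X≡Z)
    blocks-nbrs-X (there (there (here (inj₁ (_ , w≡Z))))) = here w≡Z
    blocks-nbrs-X (there (there (here (inj₂ (X≡Z , _))))) = ⊥-elim (X≢Z X≡Z)

    blocks-nbrs-Y : NbrsWithin Blocks Y [ V ]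
    blocks-nbrs-Y (here (inj₁ (Y≡V , _)))                = ⊥-elim (V≢Y (sym Y≡V))
    blocks-nbrs-Y (here (inj₂ (_ , w≡V)))                = here w≡V
    blocks-nbrs-Y (there (here (inj₁ (Y≡V , _))))        = ⊥-elim (V≢Y (sym Y≡V))
    blocks-nbrs-Y (there (here (inj₂ (Y≡Z , _))))        = ⊥-elim (Y≢Z Y≡Z)
    blocks-nbrs-Y (there (there (here (inj₁ (Y≡X , _))))) = ⊥-elim (X≢Y (sym Y≡X))
    blocks-nbrs-Y (there (there (here (inj₂ (Y≡Z , _))))) = ⊥-elim (Y≢Z Y≡Z)

    blocks-nbrs-Z : NbrsWithin Blocks Z (V ∷ X ∷ [])
    blocks-nbrs-Z (here (inj₁ (Z≡V , _)))                = ⊥-elim (V≢Z (sym Z≡V))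
    blocks-nbrs-Z (here (inj₂ (Z≡Y , _)))                = ⊥-elim (Y≢Z (sym Z≡Y))
    blocks-nbrs-Z (there (here (inj₁ (Z≡V , _))))        = ⊥-elim (V≢Z (sym Z≡V))
    blocks-nbrs-Z (there (here (inj₂ (_ , w≡V))))        = here w≡V
    blocks-nbrs-Z (there (there (here (inj₁ (Z≡X , _))))) = ⊥-elim (X≢Z (sym Z≡X))
    blocks-nbrs-Z (there (there (here (inj₂ (_ , w≡X))))) = there (here w≡X)

    block-at-Y-or-Z : Claimed (u , w) Blocks → (u ≡ Y ⊎ w ≡ Y) ⊎ (u ≡ Z ⊎ w ≡ Z)
    block-at-Y-or-Z (here (inj₁ (_ , w≡Y)))                = inj₁ (inj₂ w≡Y)
    block-at-Y-or-Z (here (inj₂ (u≡Y , _)))                = inj₁ (inj₁ u≡Y)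
    block-at-Y-or-Z (there (here (inj₁ (_ , w≡Z))))        = inj₂ (inj₂ w≡Z)
    block-at-Y-or-Z (there (here (inj₂ (u≡Z , _))))        = inj₂ (inj₁ u≡Z)
    block-at-Y-or-Z (there (there (here (inj₁ (_ , w≡Z))))) = inj₂ (inj₂ w≡Z)
    block-at-Y-or-Z (there (there (here (inj₂ (u≡Z , _))))) = inj₂ (inj₁ u≡Z)

    r-avoids : Claimed (p , q) ((V , Y) ∷ (V , Z) ∷ (X , Z) ∷ (V , X) ∷ (X , Y) ∷ []) → ¬ SameEdge (p , q) r
    r-avoids pq∈ pq≈r = r-new (claimed-resp (sameEdge-sym pq≈r) pq∈)

    -- A vertex with at most three neighbours lies on a copy only as a page, with both spines among its
    -- neighbours; this rules out Y and Z, and the copy would then lie in the six edges of F and r.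
    private
      module Contradiction (copy : HasCopy (K̂₂ 3) (F ++ Blocks ++ [ r ])) where
        open K̂₂-Copy copy

        covered : ∀ {v N} → (∀ {w} → Claimed (v , w) F → w ∈ N ⊎ Avoids vertex w) →
                  (∀ {w} → Claimed (v , w) Blocks → w ∈ N ⊎ Avoids vertex w) →
                  (∀ {w} → SameEdge (v , w) r → w ∈ N ⊎ Avoids vertex w) → CoveredBy v N
        covered inF inBlocks inR c with ++⁻ F c
        ... | inj₁ cF = inF cF
        ... | inj₂ c′ with ++⁻ Blocks c′
        ...   | inj₁ cBlocks     = inBlocks cBlocks
        ...   | inj₂ (here vw≈r) = inR vw≈r

        not-via-r : ¬ Touches v r → ∀ {w} → SameEdge (v , w) r → w ∈ N ⊎ Avoids vertex w
        not-via-r r∌v vw≈r = ⊥-elim (r∌v (_ , vw≈r))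

        none-in-F : Isolated v F → ∀ {w} → Claimed (v , w) F → w ∈ N ⊎ Avoids vertex w
        none-in-F iso c = ⊥-elim (iso c)

        Y-cover-untouched : ¬ Touches Y r → CoveredBy Y [ V ]
        Y-cover-untouched r∌Y = covered (none-in-F Y-isolated) (inj₁ ∘ blocks-nbrs-Y) (not-via-r r∌Y)

        Y-cover-touched : SameEdge (Y , s) r → CoveredBy Y (V ∷ s ∷ [])
        Y-cover-touched Ys≈r = covered (none-in-F Y-isolated) (inj₁ ∘ ∈-++⁺ˡ ∘ blocks-nbrs-Y)
          (λ Yw≈r → inj₁ (there (here (other-endpoint r-proper Ys≈r Yw≈r))))

        Z-cover-untouched : ¬ Touches Z r → CoveredBy Z (V ∷ X ∷ [])
        Z-cover-untouched r∌Z = covered (none-in-F Z-isolated) (inj₁ ∘ blocks-nbrs-Z) (not-via-r r∌Z)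

        Z-cover-touched : SameEdge (Z , s) r → CoveredBy Z (V ∷ X ∷ s ∷ [])
        Z-cover-touched Zs≈r = covered (none-in-F Z-isolated) (inj₁ ∘ ∈-++⁺ˡ ∘ blocks-nbrs-Z)
          (λ Zw≈r → inj₁ (there (there (here (other-endpoint r-proper Zs≈r Zw≈r)))))

        X-not-spine : ¬ Touches X r → ¬ SpineVertex X
        X-not-spine r∌X = not-spine cover (length-∷ʳ≤ NX NX-small)
          where
            cover : CoveredBy X (NX ++ [ Z ])
            cover = covered (inj₁ ∘ ∈-++⁺ˡ ∘ X-nbrs) (inj₁ ∘ ∈-++⁺ʳ NX ∘ blocks-nbrs-X) (not-via-r r∌X)

        V-not-spine : ¬ Touches V r → Avoids vertex Y ⊎ Avoids vertex Z → ¬ SpineVertex V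
        V-not-spine r∌V (inj₁ Y-avoided) = not-spine cover (length-∷ʳ≤ NV NV-small)
          where
            via-blocks : ∀ {w} → w ∈ Y ∷ Z ∷ [] → w ∈ NV ++ [ Z ] ⊎ Avoids vertex w
            via-blocks (here refl)        = inj₂ Y-avoided
            via-blocks (there (here w≡Z)) = inj₁ (∈-++⁺ʳ NV (here w≡Z))
            cover : CoveredBy V (NV ++ [ Z ])
            cover = covered (inj₁ ∘ ∈-++⁺ˡ ∘ V-nbrs) (via-blocks ∘ blocks-nbrs-V) (not-via-r r∌V)
        V-not-spine r∌V (inj₂ Z-avoided) = not-spine cover (length-∷ʳ≤ NV NV-small)
          where
            via-blocks : ∀ {w} → w ∈ Y ∷ Z ∷ [] → w ∈ NV ++ [ Y ] ⊎ Avoids vertex w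
            via-blocks (here w≡Y)          = inj₁ (∈-++⁺ʳ NV (here w≡Y))
            via-blocks (there (here refl)) = inj₂ Z-avoided
            cover : CoveredBy V (NV ++ [ Y ])
            cover = covered (inj₁ ∘ ∈-++⁺ˡ ∘ V-nbrs) (via-blocks ∘ blocks-nbrs-V) (not-via-r r∌V)

        Z-not-spine : ¬ SpineVertex Z
        Z-not-spine with touches? Z r
        ... | yes (_ , Zs≈r) = not-spine (Z-cover-touched Zs≈r) ≤-refl
        ... | no r∌Z         = not-spine (Z-cover-untouched r∌Z) (s≤s (s≤s z≤n))

        Y-avoided-if-untouched : ¬ Touches Y r → Avoids vertex Y
        Y-avoided-if-untouched r∌Y = pendant-avoided (s≤s z≤n) (Y-cover-untouched r∌Y)

        Y-avoided-if-Z-touched : Touches Z r → Avoids vertex Y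
        Y-avoided-if-Z-touched (_ , Zs≈r) i on with touches? Y r
        ... | no r∌Y         = Y-avoided-if-untouched r∌Y i on
        ... | yes (_ , Ys≈r) = Z-not-spine (subst SpineVertex (shared-endpoint Ys≈r Zs≈r Y≢Z)
                                 (proj₂ (both-spines (s≤s (s≤s z≤n)) on (Y-cover-touched Ys≈r))))

        Z-avoided : Avoids vertex Z
        Z-avoided i on with touches? Z r
        ... | yes (s , Zs≈r) with spine-among-first-two ≤-refl on (Z-cover-touched Zs≈r)
        ...   | inj₁ V-spine = V-not-spine r∌V (inj₁ (Y-avoided-if-Z-touched (s , Zs≈r))) V-spine
          where r∌V = untouched Zs≈r V≢Z (r-avoids (there (here sameEdge-flip)))
        ...   | inj₂ X-spine = X-not-spine r∌X X-spine
          where r∌X = untouched Zs≈r X≢Z (r-avoids (there (there (here sameEdge-flip))))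
        Z-avoided i on | no r∌Z with both-spines (s≤s (s≤s z≤n)) on (Z-cover-untouched r∌Z) | touches? X r
        ...   | _ , X-spine | no r∌X         = X-not-spine r∌X X-spine
        ...   | V-spine , _ | yes (_ , Xs≈r) = V-not-spine r∌V (inj₁ (Y-avoided-if-untouched r∌Y)) V-spine
          where
            r∌V = untouched Xs≈r V≢X (r-avoids (there (there (there (here sameEdge-flip)))))
            r∌Y = untouched Xs≈r (X≢Y ∘ sym) (r-avoids (there (there (there (there (here (inj₁ (refl , refl))))))))

        Y-avoided : Avoids vertex Y
        Y-avoided i on with touches? Y r
        ... | no r∌Y         = Y-avoided-if-untouched r∌Y i on
        ... | yes (_ , Ys≈r) =
          V-not-spine r∌V (inj₂ Z-avoided) (proj₁ (both-spines (s≤s (s≤s z≤n)) on (Y-cover-touched Ys≈r)))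
          where r∌V = untouched Ys≈r V≢Y (r-avoids (here sameEdge-flip))

        avoided-endpoint : Claimed (u , w) Blocks → Avoids vertex u ⊎ Avoids vertex w
        avoided-endpoint c with block-at-Y-or-Z c
        ... | inj₁ (inj₁ refl) = inj₁ Y-avoided
        ... | inj₁ (inj₂ refl) = inj₂ Y-avoided
        ... | inj₂ (inj₁ refl) = inj₁ Z-avoided
        ... | inj₂ (inj₂ refl) = inj₂ Z-avoided

        without-blocks : ∀ {u w} → Claimed (u , w) (F ++ Blocks ++ [ r ]) →
                         Claimed (u , w) (F ++ [ r ]) ⊎ (Avoids vertex u ⊎ Avoids vertex w)
        without-blocks c with ++⁻ F c
        ... | inj₁ cF = inj₁ (++⁺ˡ cF)
        ... | inj₂ c′ with ++⁻ Blocks c′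
        ...   | inj₁ cBlocks = inj₂ (avoided-endpoint cBlocks)
        ...   | inj₂ cr      = inj₁ (++⁺ʳ F cr)

        absurd : ⊥
        absurd = small-graph-K̂₂₃-free (≤-trans (≤-reflexive (length-++ F)) (+-mono-≤ F-small (≤-refl {1})))
                   (copy-restrict copy without-blocks)

    three-blocks-copy-free : ¬ HasCopy (K̂₂ 3) (F ++ (V , Y) ∷ (V , Z) ∷ (X , Z) ∷ r ∷ [])
    three-blocks-copy-free = Contradiction.absurd

  module _ {Y Z : ℕ} (Y-isolated : Isolated Y F) (Z-isolated : Isolated Z F)
           (V≢Y : V ≢ Y) (V≢Z : V ≢ Z) (Y≢Z : Y ≢ Z)
           {r : Edge} (r-proper : ProperEdge r) (r-new : ¬ Claimed r ((V , Y) ∷ (V , Z) ∷ [])) where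

    -- Adding the edge XZ at a fresh vertex X gives the configuration with three blocks.
    two-blocks-copy-free : ¬ HasCopy (K̂₂ 3) (F ++ (V , Y) ∷ (V , Z) ∷ r ∷ [])
    two-blocks-copy-free =
      three-blocks-copy-free (isolated⇒nbrsWithin-[] (X-isolated ∘ ++⁺ˡ)) z≤n Y-isolated Z-isolated
        (<⇒≢ V<X) V≢Y V≢Z (≢-sym (<⇒≢ Y<X)) (≢-sym (<⇒≢ Z<X)) Y≢Z r-proper r-new′
      ∘ copy-mono (claimed-++-monoʳ F add-XZ)
      where
        H : List Edge
        H = F ++ (V , Y) ∷ (V , Z) ∷ r ∷ []
        X : ℕ
        X = fresh H
        X-isolated : Isolated X H
        X-isolated = fresh-isolated H ≤-refl
        V<X : V < X
        V<X = proj₁ (claimed⇒<fresh H (++⁺ʳ F (here (inj₁ (refl , refl)))))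
        Y<X : Y < X
        Y<X = proj₂ (claimed⇒<fresh H (++⁺ʳ F (here (inj₁ (refl , refl)))))
        Z<X : Z < X
        Z<X = proj₂ (claimed⇒<fresh H (++⁺ʳ F (there (here (inj₁ (refl , refl))))))
        r-avoids-X : ∀ {w} → ¬ SameEdge (X , w) r
        r-avoids-X Xw≈r = X-isolated (++⁺ʳ F (there (there (here Xw≈r))))
        r-new′ : ¬ Claimed r ((V , Y) ∷ (V , Z) ∷ (X , Z) ∷ (V , X) ∷ (X , Y) ∷ [])
        r-new′ (here r≈VY)                                 = r-new (here r≈VY)
        r-new′ (there (here r≈VZ))                         = r-new (there (here r≈VZ))
        r-new′ (there (there (here r≈XZ)))                 = r-avoids-X (sameEdge-sym r≈XZ)
        r-new′ (there (there (there (here r≈VX))))         = r-avoids-X (sameEdge-trans sameEdge-flip (sameEdge-sym r≈VX))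
        r-new′ (there (there (there (there (here r≈XY))))) = r-avoids-X (sameEdge-sym r≈XY)
        add-XZ : ∀ {e} → Claimed e ((V , Y) ∷ (V , Z) ∷ r ∷ []) → Claimed e ((V , Y) ∷ (V , Z) ∷ (X , Z) ∷ r ∷ [])
        add-XZ (here e≈VY)                = here e≈VY
        add-XZ (there (here e≈VZ))        = there (here e≈VZ)
        add-XZ (there (there (here e≈r))) = there (there (there (here e≈r)))

-- The strategy

valid? : (h : History) (e : Edge) → Dec (ValidMove h e)
valid? h (u , w) = ¬? (u ≟ w) ×-dec ¬? (claimed? (u , w) h)

invalid⇒claimed : ∀ {h} → ProperEdge e → ¬ ValidMove h e → Claimed e h
invalid⇒claimed {e = e} {h} proper invalid = decidable-stable (claimed? e h) (λ free → invalid (proper , free))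

freshMove : (h : History) → LegalMove h
freshMove h = (fresh h , suc (fresh h)) , <⇒≢ (n<1+n (fresh h)) , fresh-isolated h ≤-refl

preferring : ∀ {h e} → Dec (ValidMove h e) → LegalMove h → LegalMove h
preferring {e = e} (yes valid) _    = e , valid
preferring         (no _)      move = move

firstValid : List Edge → (h : History) → LegalMove h
firstValid []       h = freshMove h
firstValid (e ∷ es) h = preferring (valid? h e) (firstValid es h)

firstValid-valid : ∀ {h} es → ValidMove h e → proj₁ (firstValid (e ∷ es) h) ≡ e
firstValid-valid {e = e} {h} es valid = preferred (valid? h e)
  where
    preferred : (d : Dec (ValidMove h e)) → proj₁ (preferring d (firstValid es h)) ≡ e
    preferred (yes _)      = refl
    preferred (no invalid) = ⊥-elim (invalid valid)

firstValid-invalid : ∀ {h} es → ¬ ValidMove h e → proj₁ (firstValid (e ∷ es) h) ≡ proj₁ (firstValid es h)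
firstValid-invalid {e = e} {h} es invalid = passed (valid? h e)
  where
    passed : (d : Dec (ValidMove h e)) → proj₁ (preferring d (firstValid es h)) ≡ proj₁ (firstValid es h)
    passed (yes valid) = ⊥-elim (invalid valid)
    passed (no _)      = refl

if-does : ∀ {P A : Set} (d : Dec P) {x y : A} →
          (P × (if does d then x else y) ≡ x) ⊎ (¬ P × (if does d then x else y) ≡ y)
if-does (yes p) = inj₁ (p , refl)
if-does (no ¬p) = inj₂ (¬p , refl)

-- Each vertex is computed from the prefix of the history ending where it is chosen, so later moves
-- see the same vertex.  Where two edges are planned, the first completes a book if it is still free
-- and the second creates the next threat.
module Strategy (a b c : ℕ) where

  X⟨_⟩ : History → ℕ
  X⟨ h ⟩ = fresh (take 6 h)

  -- Opaque, so that the choices are compared through their arguments instead of by evaluating the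
  -- decisions inside them.
  opaque
    chooseSW : History → ℕ × ℕ
    chooseSW h = if does (claimed? (b , X⟨ h ⟩) h) then (c , b) else (b , c)

    chooseSW-spec : ∀ h → (Claimed (b , X⟨ h ⟩) h × chooseSW h ≡ (c , b)) ⊎
                          (¬ Claimed (b , X⟨ h ⟩) h × chooseSW h ≡ (b , c))
    chooseSW-spec h = if-does (claimed? (b , X⟨ h ⟩) h)

  S⟨_⟩ : History → ℕ
  S⟨ h ⟩ = proj₁ (chooseSW (take 8 h))

  opaque
    chooseUV : History → ℕ × ℕ
    chooseUV h = if does (length (nbrs a (P2edges h)) ≤? 2) then (S⟨ h ⟩ , a) else (a , S⟨ h ⟩)

    chooseUV-spec : ∀ h → (length (nbrs a (P2edges h)) ≤ 2 × chooseUV h ≡ (S⟨ h ⟩ , a)) ⊎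
                          (¬ length (nbrs a (P2edges h)) ≤ 2 × chooseUV h ≡ (a , S⟨ h ⟩))
    chooseUV-spec h = if-does (length (nbrs a (P2edges h)) ≤? 2)

  U⟨_⟩ V⟨_⟩ Y⟨_⟩ Z⟨_⟩ T⟨_⟩ : History → ℕ
  U⟨ h ⟩ = proj₁ (chooseUV (take 10 h))
  V⟨ h ⟩ = proj₂ (chooseUV (take 10 h))
  Y⟨ h ⟩ = fresh (take 10 h)
  Z⟨ h ⟩ = fresh (take 12 h)
  T⟨ h ⟩ = fresh (take 16 h)

  plan : ℕ → History → List Edge
  plan 6  h = [ (a , X⟨ h ⟩) ]
  plan 8  h = [ (S⟨ h ⟩ , X⟨ h ⟩) ]
  plan 10 h = [ (U⟨ h ⟩ , Y⟨ h ⟩) ]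
  plan 12 h = (V⟨ h ⟩ , Y⟨ h ⟩) ∷ (U⟨ h ⟩ , Z⟨ h ⟩) ∷ []
  plan 14 h = (V⟨ h ⟩ , Z⟨ h ⟩) ∷ (X⟨ h ⟩ , Y⟨ h ⟩) ∷ []
  plan 16 h = (X⟨ h ⟩ , Z⟨ h ⟩) ∷ (U⟨ h ⟩ , T⟨ h ⟩) ∷ []
  plan 18 h = (V⟨ h ⟩ , T⟨ h ⟩) ∷ (X⟨ h ⟩ , T⟨ h ⟩) ∷ []
  plan _  h = []

  opaque
    σ : Strategy
    σ h = firstValid (plan (length h) h) h

    σ-first : ∀ h {e es} → plan (length h) h ≡ e ∷ es → ValidMove h e → proj₁ (σ h) ≡ e
    σ-first h {es = es} planned valid rewrite planned = firstValid-valid es valid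

    σ-second : ∀ h {e e′ es} → plan (length h) h ≡ e ∷ e′ ∷ es → ¬ ValidMove h e → ValidMove h e′ →
               proj₁ (σ h) ≡ e′
    σ-second h {e′ = e′} {es} planned invalid valid rewrite planned =
      trans (firstValid-invalid (e′ ∷ es) invalid) (firstValid-valid es valid)

-- The line of play

valid-move-avoids : ∀ {h m} → ValidMove h m → All (λ e → Claimed e h) L → ¬ Claimed m L
valid-move-avoids (_ , m-free) claimed m∈L with All.lookupAny claimed m∈L
... | e∈h , m≈e = m-free (claimed-resp m≈e e∈h)

just-played : ∀ A {m ms} → m ≡ e → Claimed e (A ++ m ∷ ms)
just-played A m≡e = ++⁺ʳ A (here (played m≡e))

claimed-by-reply : ∀ {h m r} → ¬ Claimed e h → ¬ SameEdge e m → Claimed e (h ++ m ∷ r ∷ []) → SameEdge e r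
claimed-by-reply {h = h} e-free e≉m c with ++⁻ h c
... | inj₁ ch                 = ⊥-elim (e-free ch)
... | inj₂ (here e≈m)         = ⊥-elim (e≉m e≈m)
... | inj₂ (there (here e≈r)) = e≈r

blocked-by-reply : ∀ {h m r} → ProperEdge e → ¬ Claimed e h → ¬ SameEdge e m →
                   ¬ ValidMove (h ++ m ∷ r ∷ []) e → SameEdge e r
blocked-by-reply proper e-free e≉m = claimed-by-reply e-free e≉m ∘ invalid⇒claimed proper

-- hₙ is the position after n moves; mₙ is P₁'s move and rₙ P₂'s reply in it.
module LineOfPlay (e₀ e₁ e₂ e₃ e₄ e₅ : Edge) (legal : LegalHistory (e₀ ∷ e₁ ∷ e₂ ∷ e₃ ∷ e₄ ∷ e₅ ∷ []))
                  {a b c : ℕ} (abc : Triangle (e₀ ∷ e₂ ∷ e₄ ∷ []) a b c) (τ : Strategy) where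
  open Strategy a b c

  h6 h7 h8 h9 h10 h11 h12 h13 h14 h15 h16 h17 h18 h19 : History
  m6 m8 m10 m12 m14 m16 m18 r7 r9 r11 r13 r15 r17 : Edge
  h6  = e₀ ∷ e₁ ∷ e₂ ∷ e₃ ∷ e₄ ∷ e₅ ∷ []
  m6  = proj₁ (σ h6)
  h7  = h6 ++ [ m6 ]
  r7  = proj₁ (τ h7)
  h8  = h7 ++ [ r7 ]
  m8  = proj₁ (σ h8)
  h9  = h8 ++ [ m8 ]
  r9  = proj₁ (τ h9)
  h10 = h9 ++ [ r9 ]
  m10 = proj₁ (σ h10)
  h11 = h10 ++ [ m10 ]
  r11 = proj₁ (τ h11)
  h12 = h11 ++ [ r11 ]
  m12 = proj₁ (σ h12)
  h13 = h12 ++ [ m12 ]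
  r13 = proj₁ (τ h13)
  h14 = h13 ++ [ r13 ]
  m14 = proj₁ (σ h14)
  h15 = h14 ++ [ m14 ]
  r15 = proj₁ (τ h15)
  h16 = h15 ++ [ r15 ]
  m16 = proj₁ (σ h16)
  h17 = h16 ++ [ m16 ]
  r17 = proj₁ (τ h17)
  h18 = h17 ++ [ r17 ]
  m18 = proj₁ (σ h18)
  h19 = h18 ++ [ m18 ]

  next-position : ∀ n {h} → play σ τ h6 n ≡ h →
                  play σ τ h6 (suc n) ≡ h ++ [ proj₁ (if isEven (length h) then σ h else τ h) ]
  next-position n refl = refl

  reaches-h13 : play σ τ h6 7 ≡ h13
  reaches-h13 = next-position 6 (next-position 5 (next-position 4 (next-position 3 (next-position 2 (next-position 1 {h7} refl)))))

  reaches-h15 : play σ τ h6 9 ≡ h15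
  reaches-h15 = next-position 8 (next-position 7 reaches-h13)

  reaches-h17 : play σ τ h6 11 ≡ h17
  reaches-h17 = next-position 10 (next-position 9 reaches-h15)

  reaches-h19 : play σ τ h6 13 ≡ h19
  reaches-h19 = next-position 12 (next-position 11 reaches-h17)

  Outcome : Set
  Outcome = Σ ℕ λ n → P1Wins (K̂₂ 3) (play σ τ h6 n)

  won-at : ∀ n {h} → play σ τ h6 n ≡ h → P1Wins (K̂₂ 3) h → Outcome
  won-at n reached win = n , subst (P1Wins (K̂₂ 3)) (sym reached) win

  reply-proper : ∀ h → ProperEdge (proj₁ (τ h))
  reply-proper h = proj₁ (proj₂ (τ h))

  reply-avoids : ∀ h → All (λ e → Claimed e h) L → ¬ Claimed (proj₁ (τ h)) L
  reply-avoids h = valid-move-avoids (proj₂ (τ h))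

  triangle-edges : List Edge
  triangle-edges = e₀ ∷ e₂ ∷ e₄ ∷ []

  in-h6 : ∀ {ms} → Claimed e triangle-edges → Claimed e (h6 ++ ms)
  in-h6 = ++⁺ˡ ∘ evens-⊆ h6

  X : ℕ
  X = X⟨ h6 ⟩

  <X : Claimed (u , w) triangle-edges → u < X × w < X
  <X = claimed⇒<fresh h6 ∘ evens-⊆ h6

  m6≡aX : m6 ≡ (a , X)
  m6≡aX = σ-first h6 refl (<⇒≢ (proj₁ (<X (Triangle.xy abc))) , fresh-unclaimed h6)

  S W : ℕ
  S = proj₁ (chooseSW h8)
  W = proj₂ (chooseSW h8)

  aSW : Triangle triangle-edges a S W
  aSW = by-cases (chooseSW-spec h8)
    where
      by-cases : ∀ {sw} → (Claimed (b , X) h8 × sw ≡ (c , b)) ⊎ (¬ Claimed (b , X) h8 × sw ≡ (b , c)) →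
                 Triangle triangle-edges a (proj₁ sw) (proj₂ sw)
      by-cases (inj₁ (_ , refl)) = triangle-swap₂₃ abc
      by-cases (inj₂ (_ , refl)) = abc

  SX-free : ¬ Claimed (S , X) h8
  SX-free = by-cases (chooseSW-spec h8)
    where
      open Triangle abc
      cX-free : Claimed (b , X) h8 → ¬ Claimed (c , X) h8
      cX-free bX-taken = unclaimed-++ h6 (fresh-unclaimed h6)
          (≉-resp (played m6≡aX) (≉-at-first (≢-sym x≢z) c≢X) ∷ ≉-resp bX≈r7 (≉-at-first (≢-sym y≢z) c≢X) ∷ [])
        where
          c≢X = <⇒≢ (proj₂ (<X xz))
          bX≈r7 : SameEdge (b , X) r7
          bX≈r7 = claimed-by-reply (fresh-unclaimed h6)
                    (≉-resp (played m6≡aX) (≉-at-first (≢-sym x≢y) (<⇒≢ (proj₂ (<X xy))))) bX-taken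
      by-cases : ∀ {sw} → (Claimed (b , X) h8 × sw ≡ (c , b)) ⊎ (¬ Claimed (b , X) h8 × sw ≡ (b , c)) →
                 ¬ Claimed (proj₁ sw , X) h8
      by-cases (inj₁ (bX-taken , refl)) = cX-free bX-taken
      by-cases (inj₂ (bX-free , refl))  = bX-free

  m8≡SX : m8 ≡ (S , X)
  m8≡SX = σ-first h8 refl (<⇒≢ (proj₂ (<X (Triangle.xy aSW))) , SX-free)

  F : List Edge
  F = P2edges h10

  aS∉F : ¬ Claimed (a , S) F
  aS∉F c with ++⁻ (P2edges h6) c
  ... | inj₁ in-p                 = evens-odds-disjoint (legal⇒unique legal) (Triangle.xy aSW) in-p
  ... | inj₂ (here aS≈r7)         = reply-avoids h7 (in-h6 (Triangle.xy aSW) ∷ []) (here (sameEdge-sym aS≈r7))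
  ... | inj₂ (there (here aS≈r9)) = reply-avoids h9 (in-h6 (Triangle.xy aSW) ∷ []) (here (sameEdge-sym aS≈r9))

  U V : ℕ
  U = U⟨ h10 ⟩
  V = V⟨ h10 ⟩

  record Spines (u v : ℕ) : Set where
    field
      uvW      : Triangle triangle-edges u v W
      uX       : Claimed (u , X) (m6 ∷ m8 ∷ [])
      vX       : Claimed (v , X) (m6 ∷ m8 ∷ [])
      v-sparse : length (nbrs v F) ≤ 2

  UV-spines : Spines U V
  UV-spines = by-cases (chooseUV-spec h10)
    where
      by-cases : ∀ {uv} → (length (nbrs a F) ≤ 2 × uv ≡ (S , a)) ⊎ (¬ length (nbrs a F) ≤ 2 × uv ≡ (a , S)) →
                 Spines (proj₁ uv) (proj₂ uv)
      by-cases (inj₁ (a-sparse , refl)) = record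
        { uvW = triangle-swap₁₂ aSW ; uX = there (here (played m8≡SX)) ; vX = here (played m6≡aX) ; v-sparse = a-sparse }
      by-cases (inj₂ (a-dense , refl))  = record
        { uvW = aSW ; uX = here (played m6≡aX) ; vX = there (here (played m8≡SX))
        ; v-sparse = m≰2⇒m+n≤5⇒n≤2 a-dense (degree-sum F (Triangle.x≢y aSW) aS∉F) }

  open Spines UV-spines
  open Triangle uvW using () renaming (x≢y to U≢V; xy to UV∈; xz to UW∈)

  U<X : U < X
  U<X = proj₁ (<X UV∈)
  V<X : V < X
  V<X = proj₂ (<X UV∈)
  W<X : W < X
  W<X = proj₂ (<X UW∈)
  X≢U : X ≢ U
  X≢U = ≢-sym (<⇒≢ U<X)
  X≢V : X ≢ V
  X≢V = ≢-sym (<⇒≢ V<X)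

  UX∈ : ∀ {ms} → Claimed (U , X) (triangle-edges ++ m6 ∷ m8 ∷ ms)
  UX∈ = ++⁺ʳ triangle-edges (++⁺ˡ uX)
  VX∈ : ∀ {ms} → Claimed (V , X) (triangle-edges ++ m6 ∷ m8 ∷ ms)
  VX∈ = ++⁺ʳ triangle-edges (++⁺ˡ vX)
  UVW∈ : ∀ {ms} → Triangle (triangle-edges ++ ms) U V W
  UVW∈ = triangle-mono ++⁺ˡ uvW
  UXV∈ : ∀ {ms} → Triangle (triangle-edges ++ m6 ∷ m8 ∷ ms) U X V
  UXV∈ = record { x≢y = ≢-sym X≢U ; y≢z = X≢V ; x≢z = U≢V ; xy = UX∈ ; yz = claimed-flip VX∈ ; xz = ++⁺ˡ UV∈ }

  Y : ℕ
  Y = Y⟨ h10 ⟩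
  X<Y : X < Y
  X<Y = proj₂ (claimed⇒<fresh h10 (++⁺ʳ h6 (here (played m6≡aX))))
  U<Y : U < Y
  U<Y = <-trans U<X X<Y
  V<Y : V < Y
  V<Y = <-trans V<X X<Y

  m10≡UY : m10 ≡ (U , Y)
  m10≡UY = σ-first h10 refl (<⇒≢ U<Y , fresh-unclaimed h10)

  UY∈ : ∀ {ms} → Claimed (U , Y) (P1edges h10 ++ m10 ∷ ms)
  UY∈ = just-played (P1edges h10) m10≡UY

  F-isolated : ∀ h → (∀ {e} → Claimed e h10 → Claimed e h) → Isolated (fresh h) F
  F-isolated h h10⊆h = fresh-isolated h ≤-refl ∘ h10⊆h ∘ odds-⊆ h10

  win-VY : ValidMove h12 (V , Y) → P1Wins (K̂₂ 3) h13
  win-VY VY-free = book-copy UVW∈ U<X V<X W<X X<Y UX∈ VX∈ UY∈ (just-played (P1edges h12) (σ-first h12 refl VY-free))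
                 , small-graph-K̂₂₃-free ≤-refl

  module VY-blocked (VY-taken : ¬ ValidMove h12 (V , Y)) where

    r11≈VY : SameEdge (V , Y) r11
    r11≈VY = blocked-by-reply (<⇒≢ V<Y) (fresh-unclaimed h10)
               (≉-resp (played m10≡UY) (≉-at-first (≢-sym U≢V) (<⇒≢ V<Y))) VY-taken

    Z : ℕ
    Z = Z⟨ h12 ⟩
    Y<Z : Y < Z
    Y<Z = proj₂ (claimed⇒<fresh h12 (++⁺ʳ h10 (here (played m10≡UY))))
    U<Z : U < Z
    U<Z = <-trans U<Y Y<Z
    V<Z : V < Z
    V<Z = <-trans V<Y Y<Z
    X<Z : X < Z
    X<Z = <-trans X<Y Y<Z

    m12≡UZ : m12 ≡ (U , Z)
    m12≡UZ = σ-second h12 refl VY-taken (<⇒≢ U<Z , fresh-unclaimed h12)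

    UZ∈ : ∀ {ms} → Claimed (U , Z) (P1edges h12 ++ m12 ∷ ms)
    UZ∈ = just-played (P1edges h12) m12≡UZ

    Y-isolated : Isolated Y F
    Y-isolated = F-isolated h10 (λ c → c)
    Z-isolated : Isolated Z F
    Z-isolated = F-isolated h12 ++⁺ˡ

    open Blockade F ≤-refl (nbrs-sound V F) v-sparse

    win-VZ : ValidMove h14 (V , Z) → P1Wins (K̂₂ 3) h15
    win-VZ VZ-free = book-copy UVW∈ U<X V<X W<X X<Z UX∈ VX∈ UZ∈ (just-played (P1edges h14) (σ-first h14 refl VZ-free))
                   , two-blocks-copy-free Y-isolated Z-isolated (<⇒≢ V<Y) (<⇒≢ V<Z) (<⇒≢ Y<Z) (reply-proper h13) r13-new
                     ∘ copy-mono (claimed-++-monoʳ F blocks)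
      where
        r13-new : ¬ Claimed r13 ((V , Y) ∷ (V , Z) ∷ [])
        r13-new (here r13≈VY)         = reply-avoids h13 (++⁺ʳ h10 (there (here r11≈VY)) ∷ []) (here r13≈VY)
        r13-new (there (here r13≈VZ)) = proj₂ VZ-free (++⁺ʳ h12 (there (here (sameEdge-sym r13≈VZ))))
        blocks : ∀ {e} → Claimed e (r11 ∷ r13 ∷ []) → Claimed e ((V , Y) ∷ (V , Z) ∷ r13 ∷ [])
        blocks (here e≈r11)         = here (sameEdge-trans e≈r11 (sameEdge-sym r11≈VY))
        blocks (there (here e≈r13)) = there (there (here e≈r13))

    module VZ-blocked (VZ-taken : ¬ ValidMove h14 (V , Z)) where

      r13≈VZ : SameEdge (V , Z) r13
      r13≈VZ = blocked-by-reply (<⇒≢ V<Z) (fresh-unclaimed h12)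
                 (≉-resp (played m12≡UZ) (≉-at-first (≢-sym U≢V) (<⇒≢ V<Z))) VZ-taken

      UZ-VZ-miss-X : ∀ {w} → All (λ m → ¬ SameEdge (X , w) m) (m12 ∷ r13 ∷ [])
      UZ-VZ-miss-X = ≉-resp (played m12≡UZ) (≉-at-first X≢U (<⇒≢ X<Z)) ∷ ≉-resp r13≈VZ (≉-at-first X≢V (<⇒≢ X<Z)) ∷ []

      XY-free : ¬ Claimed (X , Y) h14
      XY-free = unclaimed-++ h10 (fresh-unclaimed h10)
        (≉-resp (played m10≡UY) (≉-at-first X≢U (<⇒≢ X<Y)) ∷ ≉-resp r11≈VY (≉-at-first X≢V (<⇒≢ X<Y)) ∷ UZ-VZ-miss-X)

      m14≡XY : m14 ≡ (X , Y)
      m14≡XY = σ-second h14 refl VZ-taken (<⇒≢ X<Y , XY-free)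

      XY∈ : ∀ {ms} → Claimed (X , Y) (P1edges h14 ++ m14 ∷ ms)
      XY∈ = just-played (P1edges h14) m14≡XY

      win-XZ : ValidMove h16 (X , Z) → P1Wins (K̂₂ 3) h17
      win-XZ XZ-free = book-copy UXV∈ U<Y X<Y V<Y Y<Z UY∈ XY∈ UZ∈ (just-played (P1edges h16) (σ-first h16 refl XZ-free))
                     , two-blocks-copy-free Y-isolated Z-isolated (<⇒≢ V<Y) (<⇒≢ V<Z) (<⇒≢ Y<Z) (reply-proper h15) r15-new
                       ∘ copy-mono (claimed-++-monoʳ F blocks)
        where
          r15-new : ¬ Claimed r15 ((V , Y) ∷ (V , Z) ∷ [])
          r15-new = reply-avoids h15 (++⁺ʳ h10 (there (here r11≈VY)) ∷ ++⁺ʳ h12 (there (here r13≈VZ)) ∷ [])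
          blocks : ∀ {e} → Claimed e (r11 ∷ r13 ∷ r15 ∷ []) → Claimed e ((V , Y) ∷ (V , Z) ∷ r15 ∷ [])
          blocks (here e≈r11)                 = here (sameEdge-trans e≈r11 (sameEdge-sym r11≈VY))
          blocks (there (here e≈r13))         = there (here (sameEdge-trans e≈r13 (sameEdge-sym r13≈VZ)))
          blocks (there (there (here e≈r15))) = there (there (here e≈r15))

      module XZ-blocked (XZ-taken : ¬ ValidMove h16 (X , Z)) where

        r15≈XZ : SameEdge (X , Z) r15
        r15≈XZ = blocked-by-reply (<⇒≢ X<Z) XZ-free-in-h14
                   (≉-resp (played m14≡XY) (≉-at-second (≢-sym (<⇒≢ Y<Z)) (≢-sym (<⇒≢ X<Z)))) XZ-taken
          where
            XZ-free-in-h14 : ¬ Claimed (X , Z) h14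
            XZ-free-in-h14 = unclaimed-++ h12 (fresh-unclaimed h12) UZ-VZ-miss-X

        T : ℕ
        T = T⟨ h16 ⟩
        Z<T : Z < T
        Z<T = proj₂ (claimed⇒<fresh h16 (++⁺ʳ h12 (here (played m12≡UZ))))
        U<T : U < T
        U<T = <-trans U<Z Z<T
        V<T : V < T
        V<T = <-trans V<Z Z<T
        X<T : X < T
        X<T = <-trans X<Z Z<T
        Y<T : Y < T
        Y<T = <-trans Y<Z Z<T

        m16≡UT : m16 ≡ (U , T)
        m16≡UT = σ-second h16 refl XZ-taken (<⇒≢ U<T , fresh-unclaimed h16)

        UT∈ : ∀ {ms} → Claimed (U , T) (P1edges h16 ++ m16 ∷ ms)
        UT∈ = just-played (P1edges h16) m16≡UT

        P2-copy-free : ¬ HasCopy (K̂₂ 3) (P2edges h19)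
        P2-copy-free =
          three-blocks-copy-free X-nbrs (length-nbrs X (r7 ∷ r9 ∷ [])) Y-isolated Z-isolated
            (<⇒≢ V<X) (<⇒≢ V<Y) (<⇒≢ V<Z) (<⇒≢ X<Y) (<⇒≢ X<Z) (<⇒≢ Y<Z) (reply-proper h17) r17-new
          ∘ copy-mono (claimed-++-monoʳ F blocks)
          where
            X-nbrs : NbrsWithin F X (nbrs X (r7 ∷ r9 ∷ []))
            X-nbrs = nbrsWithin-++ (P2edges h6) (isolated⇒nbrsWithin-[] (fresh-isolated h6 ≤-refl ∘ odds-⊆ h6))
                                     (nbrs-sound X (r7 ∷ r9 ∷ []))
            r17-new : ¬ Claimed r17 ((V , Y) ∷ (V , Z) ∷ (X , Z) ∷ (V , X) ∷ (X , Y) ∷ [])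
            r17-new = reply-avoids h17
              ( ++⁺ʳ h10 (there (here r11≈VY)) ∷ ++⁺ʳ h12 (there (here r13≈VZ)) ∷ ++⁺ʳ h14 (there (here r15≈XZ))
              ∷ ++⁺ʳ h6 (P1-move vX) ∷ ++⁺ʳ h14 (here (played m14≡XY)) ∷ [])
              where
                P1-move : Claimed e (m6 ∷ m8 ∷ []) →
                          Claimed e (m6 ∷ r7 ∷ m8 ∷ r9 ∷ m10 ∷ r11 ∷ m12 ∷ r13 ∷ m14 ∷ r15 ∷ m16 ∷ [])
                P1-move (here e≈m6)         = here e≈m6
                P1-move (there (here e≈m8)) = there (there (here e≈m8))
            blocks : ∀ {e} → Claimed e (r11 ∷ r13 ∷ r15 ∷ r17 ∷ []) →
                             Claimed e ((V , Y) ∷ (V , Z) ∷ (X , Z) ∷ r17 ∷ [])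
            blocks (here e≈r11)                         = here (sameEdge-trans e≈r11 (sameEdge-sym r11≈VY))
            blocks (there (here e≈r13))                 = there (here (sameEdge-trans e≈r13 (sameEdge-sym r13≈VZ)))
            blocks (there (there (here e≈r15)))         = there (there (here (sameEdge-trans e≈r15 (sameEdge-sym r15≈XZ))))
            blocks (there (there (there (here e≈r17)))) = there (there (there (here e≈r17)))

        win-VT : ValidMove h18 (V , T) → P1Wins (K̂₂ 3) h19
        win-VT VT-free = book-copy UVW∈ U<X V<X W<X X<T UX∈ VX∈ UT∈ (just-played (P1edges h18) (σ-first h18 refl VT-free))
                       , P2-copy-free

        win-XT : ¬ ValidMove h18 (V , T) → P1Wins (K̂₂ 3) h19
        win-XT VT-taken = book-copy UXV∈ U<Y X<Y V<Y Y<T UY∈ XY∈ UT∈ (just-played (P1edges h18) m18≡XT)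
                        , P2-copy-free
          where
            r17≈VT : SameEdge (V , T) r17
            r17≈VT = blocked-by-reply (<⇒≢ V<T) (fresh-unclaimed h16)
                       (≉-resp (played m16≡UT) (≉-at-first (≢-sym U≢V) (<⇒≢ V<T))) VT-taken
            XT-free : ¬ Claimed (X , T) h18
            XT-free = unclaimed-++ h16 (fresh-unclaimed h16)
              (≉-resp (played m16≡UT) (≉-at-first X≢U (<⇒≢ X<T)) ∷ ≉-resp r17≈VT (≉-at-first X≢V (<⇒≢ X<T)) ∷ [])
            m18≡XT : m18 ≡ (X , T)
            m18≡XT = σ-second h18 refl VT-taken (<⇒≢ X<T , XT-free)

        outcome-VT : Dec (ValidMove h18 (V , T)) → Outcome
        outcome-VT (yes VT-free) = won-at 13 reaches-h19 (win-VT VT-free)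
        outcome-VT (no VT-taken) = won-at 13 reaches-h19 (win-XT VT-taken)

      outcome-XZ : Dec (ValidMove h16 (X , Z)) → Outcome
      outcome-XZ (yes XZ-free) = won-at 11 reaches-h17 (win-XZ XZ-free)
      outcome-XZ (no XZ-taken) = XZ-blocked.outcome-VT XZ-taken (valid? h18 _)

    outcome-VZ : Dec (ValidMove h14 (V , Z)) → Outcome
    outcome-VZ (yes VZ-free) = won-at 9 reaches-h15 (win-VZ VZ-free)
    outcome-VZ (no VZ-taken) = VZ-blocked.outcome-XZ VZ-taken (valid? h16 _)

  outcome-VY : Dec (ValidMove h12 (V , Y)) → Outcome
  outcome-VY (yes VY-free) = won-at 7 reaches-h13 (win-VY VY-free)
  outcome-VY (no VY-taken) = VY-blocked.outcome-VZ VY-taken (valid? h14 _)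

  P1-wins : Outcome
  P1-wins = outcome-VY (valid? h12 (V , Y))

lemma3p3 : (p : History) → LegalHistory p → length p ≡ 6 → P1Triangle p →
           Σ Strategy (P1WinningFrom (K̂₂ 3) p)
lemma3p3 (e₀ ∷ e₁ ∷ e₂ ∷ e₃ ∷ e₄ ∷ e₅ ∷ []) legal refl (a , b , c , a≢b , b≢c , a≢c , ab , bc , ac) =
  Strategy.σ a b c , LineOfPlay.P1-wins e₀ e₁ e₂ e₃ e₄ e₅ legal abc
  where
    abc : Triangle (e₀ ∷ e₂ ∷ e₄ ∷ []) a b c
    abc = record { x≢y = a≢b ; y≢z = b≢c ; x≢z = a≢c ; xy = ab ; yz = bc ; xz = ac }
lemma3p3 []                              _ () _
lemma3p3 (_ ∷ [])                        _ () _
lemma3p3 (_ ∷ _ ∷ [])                    _ () _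
lemma3p3 (_ ∷ _ ∷ _ ∷ [])                _ () _
lemma3p3 (_ ∷ _ ∷ _ ∷ _ ∷ [])            _ () _
lemma3p3 (_ ∷ _ ∷ _ ∷ _ ∷ _ ∷ [])        _ () _
lemma3p3 (_ ∷ _ ∷ _ ∷ _ ∷ _ ∷ _ ∷ _ ∷ _) _ () _
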